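{- For $n\ge 3$, the number of $p_2$-configurations $C$ on $P_n$ with $|v_1|^C=0$ whose induced orientation is an alternating arrow orientation equals $8\cdot 3^{n-3}$.
   Context: Parallel Diffusion on a finite simple graph $G$: a configuration assigns an integer stack size $|v|$ (possibly negative) to each vertex. In one step all vertices fire simultaneously: each vertex sends one chip to each neighbour with strictly smaller stack size. Starting from $C_0$, $C_{t+1}$ is obtained from $C_t$ by one step. A configuration $D$ is a $p_2$-configuration if there are $C_0$ and $N$ such that $C_{t+2}=C_t$ and $C_{t+1}\ne C_t$ for all $t\ge N$, and $D=C_t$ for some $t\ge N$. The path $P_n$ has vertices $v_1,\dots,v_n$ and edges $e_i=v_iv_{i+1}$, drawn horizontally with $v_1$ rightmost. A configuration induces the orientation in which each edge is directed from its endpoint with larger stack size to its endpoint with smaller stack size, and is flat if equal. A directed edge $e_i$ is a right edge if directed $v_{i+1}\to v_i$ and a left edge if directed $v_i\to v_{i+1}$. An alternating arrow orientation is one with no flat edges in which $e_i$ and $e_{i+1}$ are never both right or both left, for every $i$. -}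

module Defs where

open import Data.Bool using (Bool; true; false; _∨_; if_then_else_)
open import Data.Nat as ℕ using (ℕ; zero; suc; _≡ᵇ_; _<_; _≤_)
open import Data.Integer as ℤ using (ℤ; +_; -[1+_]; _+_)
open import Data.Nat.Properties using (<-trans; n<1+n; ≤-trans)
open import Data.Fin using (Fin; toℕ; fromℕ<)
open import Data.Vec using (Vec; lookup; tabulate)
open import Data.List using (List; foldr; allFin)
open import Data.Product using (Σ; ∃; _×_; _,_)
open import Relation.Nullary using (¬_; does)
open import Relation.Binary.PropositionalEquality using (_≡_; _≢_)

record Graph (n : ℕ) : Set where
  field
    adj     : Fin n → Fin n → Bool
    symm    : ∀ u v → adj u v ≡ adj v u
    irrefl  : ∀ v → adj v v ≡ false

Config : ℕ → Set
Config n = Vec ℤ n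

-- Net chip flow into a vertex with stack size b from a neighbour with
-- stack size a: +1 if a > b (neighbour fires to us), -1 if a < b (we fire
-- to the neighbour), 0 otherwise.
flowIn : ℤ → ℤ → ℤ
flowIn a b =
  if does (b ℤ.<? a) then + 1
  else if does (a ℤ.<? b) then -[1+ 0 ]
  else + 0

step : ∀ {n} → Graph n → Config n → Config n
step {n} G c = tabulate λ v →
  foldr (λ u acc → (if Graph.adj G u v then flowIn (lookup c u) (lookup c v) else + 0) + acc)
        (lookup c v) (allFin n)

run : ∀ {n} → Graph n → ℕ → Config n → Config n
run G zero    c = c
run G (suc t) c = step G (run G t c)

IsP2Config : ∀ {n} → Graph n → Config n → Set
IsP2Config G D =
  Σ (Config _) λ C₀ → Σ ℕ λ N →
    (∀ t → N ≤ t → run G (suc (suc t)) C₀ ≡ run G t C₀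
                 × run G (suc t) C₀ ≢ run G t C₀)
    × (Σ ℕ λ t → N ≤ t × D ≡ run G t C₀)

-- The path P_n : vertex index i : Fin n stands for v_{i+1};
-- edges e_{i+1} = v_{i+1} v_{i+2}, i.e. between indices i and i+1.

pathAdj : ∀ {n} → Fin n → Fin n → Bool
pathAdj i j = (suc (toℕ i) ≡ᵇ toℕ j) ∨ (suc (toℕ j) ≡ᵇ toℕ i)

Path : (n : ℕ) → Graph n
Path n = record { adj = pathAdj ; symm = symm ; irrefl = irr }
  where
  open import Data.Bool.Properties using (∨-comm)
  symm : ∀ (u v : Fin n) → pathAdj u v ≡ pathAdj v u
  symm u v = ∨-comm (suc (toℕ u) ≡ᵇ toℕ v) (suc (toℕ v) ≡ᵇ toℕ u)
  lem : ∀ m → (suc m ≡ᵇ m) ≡ false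
  lem zero = Relation.Binary.PropositionalEquality.refl
  lem (suc m) = lem m
  irr : ∀ (v : Fin n) → pathAdj v v ≡ false
  irr v rewrite lem (toℕ v) = Relation.Binary.PropositionalEquality.refl

data Dir : Set where
  right left flat : Dir

-- right edge: directed v_{i+1} → v_i  (|v_{i+1}| > |v_i|)
-- left edge : directed v_i → v_{i+1}  (|v_i| > |v_{i+1}|)
edgeDir : ℤ → ℤ → Dir
edgeDir a b =
  if does (a ℤ.<? b) then right
  else if does (b ℤ.<? a) then left
  else flat

-- Direction of edge e_{i+1} (between indices i and i+1), 0-based i.
dirOf : ∀ {n} → Config n → (i : ℕ) → suc i < n → Dir
dirOf c i p = edgeDir (lookup c (fromℕ< (<-trans (n<1+n i) p))) (lookup c (fromℕ< p))

IsAlternatingArrow : ∀ {n} → Config n → Set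
IsAlternatingArrow {n} c =
  (∀ i (p : suc i < n) → dirOf c i p ≢ flat)
  × (∀ i (p : suc i < n) (q : suc (suc i) < n) →
       ¬ (dirOf c i p ≡ right × dirOf c (suc i) q ≡ right)
     × ¬ (dirOf c i p ≡ left × dirOf c (suc i) q ≡ left))

-- Index of v_1 (rightmost vertex) in P_n, n ≥ 1.
v₁ : ∀ {n} → 1 ≤ n → Fin n
v₁ p = fromℕ< p

Counted : ∀ n → 1 ≤ n → Config n → Set
Counted n p C = IsP2Config (Path n) C × lookup C (v₁ p) ≡ + 0 × IsAlternatingArrow C

module Submission where

-- A p₂-configuration is exactly one that two steps fix and one step moves.  On a path the
-- induced orientation is alternating exactly when every vertex is a strict local extremum (a
-- zigzag).  Then each local minimum receives one chip from every neighbour and each local maximum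
-- sends one to every neighbour, so one step adds ±deg to every stack.  The result is again a
-- zigzag, with every edge reversed, iff the rise of each edge lies strictly between 0 and the sum
-- of the degrees of its ends; stepping once more then restores the configuration.  Conversely, a
-- zigzag of period two must be of this kind, because a vertex can only undo a change of ±deg if
-- every neighbour sends (or takes) a chip back.  With |v₁| = 0 such a configuration is fixed by
-- its orientation and its rises, with 2 choices on each end edge and 3 on each of the n − 3 inner
-- edges: 2 · 2 · 3^(n−3) · 2 in all.

open import Defs
open import Data.Nat using (ℕ; _≤_; _*_; _^_; _∸_; s≤s; z≤n)
open import Data.Nat.Properties using (≤-trans)
open import Data.List using (List; length)
open import Data.List.Relation.Unary.Unique.Propositional using (Unique)
open import Data.List.Membership.Propositional using (_∈_)
open import Data.Product using (Σ; _×_)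
open import Function.Bundles using (_⇔_)
open import Relation.Binary.PropositionalEquality using (_≡_)

open import Data.Bool using (Bool; true; false; not; if_then_else_)
open import Data.Empty using (⊥-elim)
open import Data.Fin using (Fin; zero; suc)
open import Data.Integer as ℤ using (ℤ; +_; -[1+_]; _+_; _-_; -_; _<_; +<+; -<-; -<+)
open import Data.Integer.Properties as ℤP
  using (+-identityˡ; +-identityʳ; +-assoc; +-inverseʳ; <-asym; +-monoˡ-<)
open import Data.Integer.Tactic.RingSolver using (solve-∀)
open import Algebra.Properties.AbelianGroup ℤP.+-0-abelianGroup
  using (identityˡ-unique; inverseˡ-unique; xyx⁻¹≈y; ∙-cancelˡ)
open import Data.List as L using (foldr; _++_)
open import Data.List.Membership.Propositional using (find; lose)
open import Data.List.Membership.Propositional.Properties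
  using (∈-map⁺; ∈-map⁻; ∈-concatMap⁺; ∈-concatMap⁻; ∈-upTo⁺; ∈-upTo⁻; ∈-++⁺ˡ; ∈-++⁺ʳ; ∈-++⁻)
open import Data.List.Properties using (length-map; length-upTo; length-++)
open import Data.List.Relation.Binary.Disjoint.Propositional using (Disjoint)
import Data.List.Relation.Unary.All as All
import Data.List.Relation.Unary.All.Properties as All
import Data.List.Relation.Unary.AllPairs as AllPairs
import Data.List.Relation.Unary.AllPairs.Properties as AllPairs
open import Data.List.Relation.Unary.Any using (here)
import Data.List.Relation.Unary.Unique.Propositional.Properties as Unique
open import Data.Maybe using (Maybe; just; nothing; is-just)
open import Data.Nat as ℕ using (zero; suc)
import Data.Nat.Tactic.RingSolver as ℕRing
open import Data.Product using (∃; _,_; proj₁; proj₂)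
open import Data.Sum using (_⊎_; inj₁; inj₂)
open import Data.Unit using (⊤; tt)
open import Data.Vec as V using (Vec; []; _∷_; lookup)
open import Data.Vec.Properties using (tabulate-cong; tabulate∘lookup; ∷-injectiveˡ; ∷-injectiveʳ)
open import Function using (_∘_)
open import Function.Bundles using (mk⇔; Equivalence)
open import Function.Properties.Equivalence using () renaming (trans to ⇔-trans; sym to ⇔-sym)
open import Relation.Binary.PropositionalEquality
  using (refl; sym; trans; cong; cong₂; subst; _≢_; module ≡-Reasoning)
open import Relation.Nullary using (¬_; yes; no)
open import Relation.Nullary.Decidable using (dec-true; dec-false)

module _ {n} (G : Graph n) where

  run-alternates : ∀ {c} → step G (step G c) ≡ c → ∀ t → run G t c ≡ c ⊎ run G t c ≡ step G c
  run-alternates ss zero = inj₁ refl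
  run-alternates ss (suc t) with run-alternates ss t
  ... | inj₁ e = inj₂ (cong (step G) e)
  ... | inj₂ e = inj₁ (trans (cong (step G) e) ss)

  p2Config⇒period2 : ∀ {D} → IsP2Config G D → step G (step G D) ≡ D
  p2Config⇒period2 (C₀ , N , periodic , t , N≤t , refl) = proj₁ (periodic t N≤t)

  period2⇒p2Config : ∀ {c} → step G (step G c) ≡ c → step G c ≢ c → IsP2Config G c
  period2⇒p2Config {c} ss moves = c , 0 , periodic , 0 , z≤n , refl
    where
    periodic : ∀ t → 0 ℕ.≤ t → run G (suc (suc t)) c ≡ run G t c × run G (suc t) c ≢ run G t c
    periodic t _ with run-alternates ss t
    ... | inj₁ e rewrite e = ss , moves
    ... | inj₂ e rewrite e = cong (step G) ss , λ e′ → moves (sym (trans (sym ss) e′))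

sumFin : ∀ {k} → (Fin k → ℤ) → ℤ
sumFin {zero}  f = + 0
sumFin {suc k} f = f zero + sumFin (f ∘ suc)

sumFin-≡0 : ∀ {k} (f : Fin k → ℤ) → (∀ i → f i ≡ + 0) → sumFin f ≡ + 0
sumFin-≡0 {zero}  f f≡0 = refl
sumFin-≡0 {suc k} f f≡0 = cong₂ _+_ (f≡0 zero) (sumFin-≡0 (f ∘ suc) (f≡0 ∘ suc))

foldr-tabulate : ∀ {k} {A : Set} (g : Fin k → A) (f : A → ℤ) a →
  foldr (λ u acc → f u + acc) a (L.tabulate g) ≡ sumFin (f ∘ g) + a
foldr-tabulate {zero}  g f a = sym (+-identityˡ a)
foldr-tabulate {suc k} g f a =
  trans (cong (_+_ (f (g zero))) (foldr-tabulate (g ∘ suc) f a)) (sym (+-assoc (f (g zero)) _ a))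

flowFrom : Maybe ℤ → ℤ → ℤ
flowFrom nothing  b = + 0
flowFrom (just a) b = flowIn a b

head? : ∀ {k} → Vec ℤ k → Maybe ℤ
head? []      = nothing
head? (y ∷ _) = just y

-- Index 0 is v₁, the rightmost vertex; p is the stack of the vertex preceding the segment, if any.
pathStep : Maybe ℤ → ∀ {k} → Vec ℤ k → Vec ℤ k
pathStep p []       = []
pathStep p (x ∷ xs) = flowFrom p x + flowFrom (head? xs) x + x ∷ pathStep (just x) xs

inflow : Maybe ℤ → ∀ {k} → Vec ℤ k → Fin k → ℤ
inflow p (x ∷ xs) zero    = flowFrom p x + flowFrom (head? xs) x
inflow p (x ∷ xs) (suc w) = inflow (just x) xs w

lookup-pathStep : ∀ p {k} (c : Vec ℤ k) w → lookup (pathStep p c) w ≡ inflow p c w + lookup c w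
lookup-pathStep p (x ∷ xs) zero    = refl
lookup-pathStep p (x ∷ xs) (suc w) = lookup-pathStep (just x) xs w

flowFromPrev : Maybe ℤ → ∀ {k} → Vec ℤ k → Fin k → ℤ
flowFromPrev p (y ∷ _) zero    = flowFrom p y
flowFromPrev p (_ ∷ _) (suc _) = + 0

flowFromPrev-nothing : ∀ {k} (c : Vec ℤ k) w → flowFromPrev nothing c w ≡ + 0
flowFromPrev-nothing (_ ∷ _) zero    = refl
flowFromPrev-nothing (_ ∷ _) (suc _) = refl

pathFlow : ∀ {k} → Vec ℤ k → Fin k → Fin k → ℤ
pathFlow c v u = if pathAdj u v then flowIn (lookup c u) (lookup c v) else + 0

inflow-pathFlow : ∀ p {k} (c : Vec ℤ k) w → flowFromPrev p c w + sumFin (pathFlow c w) ≡ inflow p c w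
inflow-pathFlow p (x ∷ [])     zero    = refl
inflow-pathFlow p (x ∷ y ∷ ys) zero    = cong (_+_ (flowFrom p x)) (begin
  + 0 + (flowIn y x + sumFin (λ i → pathFlow (x ∷ y ∷ ys) zero (suc (suc i))))
    ≡⟨ +-identityˡ _ ⟩
  flowIn y x + sumFin (λ i → pathFlow (x ∷ y ∷ ys) zero (suc (suc i)))
    ≡⟨ cong (_+_ (flowIn y x)) (sumFin-≡0 (λ i → pathFlow (x ∷ y ∷ ys) zero (suc (suc i)))
                                           (λ _ → refl)) ⟩
  flowIn y x + + 0
    ≡⟨ +-identityʳ _ ⟩
  flowIn y x ∎)
  where open ≡-Reasoning
inflow-pathFlow p (x ∷ y ∷ ys) (suc zero)    = trans (+-identityˡ _) (inflow-pathFlow (just x) (y ∷ ys) zero)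
inflow-pathFlow p (x ∷ y ∷ ys) (suc (suc w)) = trans (+-identityˡ _) (inflow-pathFlow (just x) (y ∷ ys) (suc w))

step-Path : ∀ {n} (c : Config n) → step (Path n) c ≡ pathStep nothing c
step-Path {n} c = trans (tabulate-cong atVertex) (tabulate∘lookup (pathStep nothing c))
  where
  open ≡-Reasoning
  atVertex : ∀ w → foldr (λ u acc → pathFlow c w u + acc) (lookup c w) (L.allFin n)
                   ≡ lookup (pathStep nothing c) w
  atVertex w = begin
    foldr (λ u acc → pathFlow c w u + acc) (lookup c w) (L.allFin n)
      ≡⟨ foldr-tabulate (λ u → u) (pathFlow c w) (lookup c w) ⟩
    sumFin (pathFlow c w) + lookup c w
      ≡⟨ cong (_+ lookup c w) (sym (+-identityˡ (sumFin (pathFlow c w)))) ⟩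
    + 0 + sumFin (pathFlow c w) + lookup c w
      ≡⟨ cong (λ a → a + sumFin (pathFlow c w) + lookup c w) (sym (flowFromPrev-nothing c w)) ⟩
    flowFromPrev nothing c w + sumFin (pathFlow c w) + lookup c w
      ≡⟨ cong (_+ lookup c w) (inflow-pathFlow nothing c w) ⟩
    inflow nothing c w + lookup c w
      ≡⟨ sym (lookup-pathStep nothing c w) ⟩
    lookup (pathStep nothing c) w ∎

infix 4 _<[_]_ _<[_]?_

_<[_]_ : ℤ → Bool → ℤ → Set
a <[ true  ] b = a < b
a <[ false ] b = b < a

_<[_]?_ : ℤ → Bool → Maybe ℤ → Set
a <[ v ]? nothing = ⊤
a <[ v ]? just b  = a <[ v ] b

<[]-flip : ∀ v {a b} → a <[ v ] b → b <[ not v ] a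
<[]-flip true  a<b = a<b
<[]-flip false b<a = b<a

<[]-unflip : ∀ v {a b} → a <[ not v ] b → b <[ v ] a
<[]-unflip true  b<a = b<a
<[]-unflip false a<b = a<b

signed : Bool → ℕ → ℤ
signed true  m = + m
signed false m = - (+ m)

signed-not : ∀ v m → signed (not v) m ≡ - signed v m
signed-not true  m = refl
signed-not false m = sym (ℤP.neg-involutive (+ m))

<[]⇒flowIn≡signed : ∀ w {a b} → b <[ w ] a → flowIn a b ≡ signed w 1
<[]⇒flowIn≡signed true  {a} {b} b<a rewrite dec-true (b ℤ.<? a) b<a = refl
<[]⇒flowIn≡signed false {a} {b} a<b rewrite dec-false (b ℤ.<? a) (<-asym a<b) | dec-true (a ℤ.<? b) a<b = refl

flowIn≡signed⇒<[] : ∀ w a b → flowIn a b ≡ signed w 1 → b <[ w ] a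
flowIn≡signed⇒<[] w a b e with b ℤ.<? a | a ℤ.<? b
flowIn≡signed⇒<[] true  a b e  | yes b<a | _       = b<a
flowIn≡signed⇒<[] false a b () | yes _   | _
flowIn≡signed⇒<[] true  a b () | no _    | yes _
flowIn≡signed⇒<[] false a b e  | no _    | yes a<b = a<b
flowIn≡signed⇒<[] true  a b () | no _    | no _
flowIn≡signed⇒<[] false a b () | no _    | no _

data FlowValue : ℤ → Set where
  gain : FlowValue (+ 1)
  loss : FlowValue -[1+ 0 ]
  none : FlowValue (+ 0)

flowIn-value : ∀ a b → FlowValue (flowIn a b)
flowIn-value a b with b ℤ.<? a | a ℤ.<? b
... | yes _ | _     = gain
... | no _  | yes _ = loss
... | no _  | no _  = none

Zigzag : Bool → ∀ {k} → Vec ℤ k → Set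
Zigzag v []           = ⊤
Zigzag v (x ∷ [])     = ⊤
Zigzag v (x ∷ y ∷ ys) = x <[ v ] y × Zigzag (not v) (y ∷ ys)

positive : ℕ → Bool
positive zero    = false
positive (suc _) = true

pull : Bool → Bool → ℤ
pull false v = + 0
pull true  v = signed v 1

-- In a zigzag every vertex is a strict local extremum, so it gains (v = true) or loses one chip per neighbour.
zigzagStep : Bool → Bool → ∀ {k} → Vec ℤ k → Vec ℤ k
zigzagStep hasPrev v []                  = []
zigzagStep hasPrev v (_∷_ {k} x xs) = pull hasPrev v + pull (positive k) v + x ∷ zigzagStep true (not v) xs

flowFrom-zigzag : ∀ v {x} m → x <[ v ]? m → flowFrom m x ≡ pull (is-just m) v
flowFrom-zigzag v nothing  _   = refl
flowFrom-zigzag v (just a) x<a = <[]⇒flowIn≡signed v x<a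

pathStep-zigzag : ∀ p v x {k} (xs : Vec ℤ k) → x <[ v ]? p → Zigzag v (x ∷ xs) →
  pathStep p (x ∷ xs) ≡ zigzagStep (is-just p) v (x ∷ xs)
pathStep-zigzag p v x []       px _          = cong (λ a → a + + 0 + x ∷ []) (flowFrom-zigzag v p px)
pathStep-zigzag p v x (y ∷ ys) px (x<y , zz) =
  cong₂ _∷_ (cong₂ (λ a b → a + b + x) (flowFrom-zigzag v p px) (flowFrom-zigzag v (just y) x<y))
            (pathStep-zigzag (just x) (not v) y ys (<[]-flip v x<y) zz)

pull-not : ∀ b v → pull b (not v) ≡ - pull b v
pull-not false v = refl
pull-not true  v = signed-not v 1

zigzagStep-involutive : ∀ hasPrev v {k} (c : Vec ℤ k) → zigzagStep hasPrev (not v) (zigzagStep hasPrev v c) ≡ c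
zigzagStep-involutive hasPrev v []                 = refl
zigzagStep-involutive hasPrev v (_∷_ {k} x xs) = cong₂ _∷_ head (zigzagStep-involutive true (not v) xs)
  where
  cancel : ∀ a b x → - a + - b + (a + b + x) ≡ x
  cancel = solve-∀
  head : pull hasPrev (not v) + pull (positive k) (not v) + (pull hasPrev v + pull (positive k) v + x) ≡ x
  head rewrite pull-not hasPrev v | pull-not (positive k) v = cancel (pull hasPrev v) (pull (positive k) v) x

zigzagStep-moves : ∀ hasPrev v x y {k} (ys : Vec ℤ k) → zigzagStep hasPrev v (x ∷ y ∷ ys) ≢ x ∷ y ∷ ys
zigzagStep-moves hasPrev v x y ys e = nonzero hasPrev v (identityˡ-unique _ x (∷-injectiveˡ e))
  where
  nonzero : ∀ hasPrev v → pull hasPrev v + signed v 1 ≢ + 0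
  nonzero false true  ()
  nonzero false false ()
  nonzero true  true  ()
  nonzero true  false ()

-- Flows are at most one chip per edge, so undoing a gain (or loss) of two chips needs both flows.
flows-saturated : ∀ v {f g} → FlowValue f → FlowValue g →
  f + g + (signed v 1 + signed v 1) ≡ + 0 → g ≡ signed (not v) 1
flows-saturated true  _    loss _  = refl
flows-saturated false _    gain _  = refl
flows-saturated true  gain gain ()
flows-saturated true  loss gain ()
flows-saturated true  none gain ()
flows-saturated true  gain none ()
flows-saturated true  loss none ()
flows-saturated true  none none ()
flows-saturated false gain loss ()
flows-saturated false loss loss ()
flows-saturated false none loss ()
flows-saturated false gain none ()
flows-saturated false loss none ()
flows-saturated false none none ()

nextFlow-saturated : ∀ p v {b g} → FlowValue g →
  flowFrom p b + g + (pull (is-just p) v + signed v 1) ≡ + 0 → g ≡ signed (not v) 1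
nextFlow-saturated nothing  v {g = g} _  e =
  trans (inverseˡ-unique g (signed v 1) (trans (reassoc g (signed v 1)) e)) (sym (signed-not v 1))
  where
  reassoc : ∀ g s → g + s ≡ + 0 + g + (+ 0 + s)
  reassoc = solve-∀
nextFlow-saturated (just a) v {b}   fg e = flows-saturated v (flowIn-value a b) fg e

period2⇒zigzag : ∀ p v {k} (c : Vec ℤ k) →
  pathStep p (zigzagStep (is-just p) v c) ≡ c → Zigzag (not v) (zigzagStep (is-just p) v c)
period2⇒zigzag p v []           _ = tt
period2⇒zigzag p v (x ∷ [])     _ = tt
period2⇒zigzag p v (x ∷ _∷_ {k} y ys) e =
  flowIn≡signed⇒<[] (not v) y′ x′ (nextFlow-saturated p v (flowIn-value y′ x′) balance) ,
  period2⇒zigzag (just x′) (not v) (y ∷ ys) (∷-injectiveʳ e)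
  where
  x′ = pull (is-just p) v + signed v 1 + x
  y′ = pull true (not v) + pull (positive k) (not v) + y
  balance : flowFrom p x′ + flowIn y′ x′ + (pull (is-just p) v + signed v 1) ≡ + 0
  balance = identityˡ-unique _ x (trans (+-assoc (flowFrom p x′ + flowIn y′ x′) _ x) (∷-injectiveˡ e))

arrow : Bool → Dir
arrow true  = right
arrow false = left

arrow≢flat : ∀ v → arrow v ≢ flat
arrow≢flat true  ()
arrow≢flat false ()

<[]⇒edgeDir≡arrow : ∀ v {x y} → x <[ v ] y → edgeDir x y ≡ arrow v
<[]⇒edgeDir≡arrow true  {x} {y} x<y rewrite dec-true (x ℤ.<? y) x<y = refl
<[]⇒edgeDir≡arrow false {x} {y} y<x rewrite dec-false (x ℤ.<? y) (<-asym y<x) | dec-true (y ℤ.<? x) y<x = refl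

edgeDir≡arrow⇒<[] : ∀ v x y → edgeDir x y ≡ arrow v → x <[ v ] y
edgeDir≡arrow⇒<[] v x y e with x ℤ.<? y | y ℤ.<? x
edgeDir≡arrow⇒<[] true  x y e  | yes x<y | _       = x<y
edgeDir≡arrow⇒<[] false x y () | yes _   | _
edgeDir≡arrow⇒<[] true  x y () | no _    | yes _
edgeDir≡arrow⇒<[] false x y e  | no _    | yes y<x = y<x
edgeDir≡arrow⇒<[] true  x y () | no _    | no _
edgeDir≡arrow⇒<[] false x y () | no _    | no _

arrow-if-not-flat : ∀ d → d ≢ flat → ∃ λ v → d ≡ arrow v
arrow-if-not-flat right _  = true , refl
arrow-if-not-flat left  _  = false , refl
arrow-if-not-flat flat  d≢flat = ⊥-elim (d≢flat refl)

NotBoth : Dir → Dir → Set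
NotBoth a b = ¬ (a ≡ right × b ≡ right) × ¬ (a ≡ left × b ≡ left)

notBoth-arrow : ∀ v → NotBoth (arrow v) (arrow (not v))
notBoth-arrow true  = (λ ()) , (λ ())
notBoth-arrow false = (λ ()) , (λ ())

notBoth⇒alternates : ∀ v w {a b} → a ≡ arrow v → b ≡ arrow w → NotBoth a b → w ≡ not v
notBoth⇒alternates true  true  refl refl (¬rr , _) = ⊥-elim (¬rr (refl , refl))
notBoth⇒alternates true  false refl refl _         = refl
notBoth⇒alternates false true  refl refl _         = refl
notBoth⇒alternates false false refl refl (_ , ¬ll) = ⊥-elim (¬ll (refl , refl))

zigzag-noFlat : ∀ v {k} (c : Vec ℤ k) → Zigzag v c → ∀ i (p : suc i ℕ.< k) → dirOf c i p ≢ flat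
zigzag-noFlat v (x ∷ y ∷ ys) (x<y , _) zero    p       = arrow≢flat v ∘ trans (sym (<[]⇒edgeDir≡arrow v x<y))
zigzag-noFlat v (x ∷ y ∷ ys) (_ , zz)  (suc i) (s≤s p) = zigzag-noFlat (not v) (y ∷ ys) zz i p
zigzag-noFlat v (x ∷ [])     _         zero    (s≤s ())

zigzag-notBoth : ∀ v {k} (c : Vec ℤ k) → Zigzag v c →
  ∀ i (p : suc i ℕ.< k) (q : suc (suc i) ℕ.< k) → NotBoth (dirOf c i p) (dirOf c (suc i) q)
zigzag-notBoth v (x ∷ y ∷ z ∷ zs) (x<y , y<z , _) zero p q
  rewrite <[]⇒edgeDir≡arrow v x<y | <[]⇒edgeDir≡arrow (not v) y<z = notBoth-arrow v
zigzag-notBoth v (x ∷ y ∷ ys) (_ , zz) (suc i) (s≤s p) (s≤s q) = zigzag-notBoth (not v) (y ∷ ys) zz i p q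
zigzag-notBoth v (x ∷ [])     _        zero    (s≤s ()) _
zigzag-notBoth v (x ∷ y ∷ [])  _       zero    _        (s≤s (s≤s ()))

zigzag⇒alternating : ∀ v {k} (c : Vec ℤ k) → Zigzag v c → IsAlternatingArrow c
zigzag⇒alternating v c zz = zigzag-noFlat v c zz , zigzag-notBoth v c zz

alternating-tail : ∀ {k} x (c : Vec ℤ k) → IsAlternatingArrow (x ∷ c) → IsAlternatingArrow c
alternating-tail x c (noFlat , notBoth) =
  (λ i p → noFlat (suc i) (s≤s p)) , (λ i p q → notBoth (suc i) (s≤s p) (s≤s q))

alternating⇒zigzag-from : ∀ v x y {k} (ys : Vec ℤ k) → IsAlternatingArrow (x ∷ y ∷ ys) →
  edgeDir x y ≡ arrow v → Zigzag v (x ∷ y ∷ ys)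
alternating⇒zigzag-from v x y []       _   e = edgeDir≡arrow⇒<[] v x y e , tt
alternating⇒zigzag-from v x y (z ∷ zs) alt e =
  edgeDir≡arrow⇒<[] v x y e , alternating⇒zigzag-from (not v) y z zs (alternating-tail x _ alt) e′
  where
  e′ : edgeDir y z ≡ arrow (not v)
  e′ with arrow-if-not-flat (edgeDir y z) (proj₁ alt 1 (s≤s (s≤s (s≤s z≤n))))
  ... | w , ew =
    trans ew (cong arrow (notBoth⇒alternates v w e ew (proj₂ alt 0 (s≤s (s≤s z≤n)) (s≤s (s≤s (s≤s z≤n))))))

alternating⇒zigzag : ∀ {k} (c : Vec ℤ (suc (suc k))) → IsAlternatingArrow c → ∃ λ v → Zigzag v c
alternating⇒zigzag (x ∷ y ∷ ys) alt with arrow-if-not-flat (edgeDir x y) (proj₁ alt 0 (s≤s (s≤s z≤n)))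
... | v , e = v , alternating⇒zigzag-from v x y ys alt e

window : Bool → ℕ → List ℤ
window v d = L.map (signed v ∘ suc) (L.upTo (d ∸ 1))

∈-window⇒ : ∀ v d {j} → j ∈ window v d → + 0 <[ v ] j × j <[ v ] signed v d
∈-window⇒ v (suc e) j∈ with ∈-map⁻ (signed v ∘ suc) j∈
∈-window⇒ true  (suc e) j∈ | m , m∈ , refl = +<+ (s≤s z≤n) , +<+ (s≤s (∈-upTo⁻ m∈))
∈-window⇒ false (suc e) j∈ | m , m∈ , refl = -<+ , -<- (∈-upTo⁻ m∈)

∈-window⇐ : ∀ v d {j} → + 0 <[ v ] j → j <[ v ] signed v d → j ∈ window v d
∈-window⇐ true  (suc e) {+ suc m}   _        (+<+ (s≤s m<e)) = ∈-map⁺ (signed true ∘ suc) (∈-upTo⁺ m<e)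
∈-window⇐ true  zero    {+ suc m}   _        (+<+ ())
∈-window⇐ true  d       {+ zero}    (+<+ ()) _
∈-window⇐ false (suc e) { -[1+ m ]} _        (-<- m<e)       = ∈-map⁺ (signed false ∘ suc) (∈-upTo⁺ m<e)
∈-window⇐ false zero    { -[1+ m ]} _        ()
∈-window⇐ false d       {+ m}       (+<+ ()) _

<[]-shift : ∀ v c {a b a′ b′} → a + c ≡ a′ → b + c ≡ b′ → a <[ v ] b → a′ <[ v ] b′
<[]-shift true  c refl refl a<b = +-monoˡ-< c a<b
<[]-shift false c refl refl b<a = +-monoˡ-< c b<a

-- deg x + deg y for an edge xy, given whether x has a predecessor and y a successor on the path.
edgeSpan : Bool → Bool → ℕ
edgeSpan false false = 2
edgeSpan false true  = 3
edgeSpan true  false = 3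
edgeSpan true  true  = 4

pull-gap : ∀ hasPrev hasNext v →
  pull hasPrev v + signed v 1 - (pull true (not v) + pull hasNext (not v)) ≡ signed v (edgeSpan hasPrev hasNext)
pull-gap false false true  = refl
pull-gap false false false = refl
pull-gap false true  true  = refl
pull-gap false true  false = refl
pull-gap true  false true  = refl
pull-gap true  false false = refl
pull-gap true  true  true  = refl
pull-gap true  true  false = refl

<[]-rise : ∀ v x y → x <[ v ] y ⇔ + 0 <[ v ] y - x
<[]-rise v x y = mk⇔
  (<[]-shift v (- x) (+-inverseʳ x) refl)
  (<[]-shift v x (+-identityˡ x) (minus-plus x y))
  where
  minus-plus : ∀ x y → y - x + x ≡ y
  minus-plus = solve-∀

<[]-exchange : ∀ v a b x y → b + y <[ v ] a + x ⇔ y - x <[ v ] a - b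
<[]-exchange v a b x y = mk⇔
  (<[]-shift v (- x - b) (left-down x y b) (right-down x a b))
  (<[]-shift v (x + b) (left-up x y b) (right-up x a b))
  where
  left-down : ∀ x y b → b + y + (- x - b) ≡ y - x
  left-down = solve-∀
  right-down : ∀ x a b → a + x + (- x - b) ≡ a - b
  right-down = solve-∀
  left-up : ∀ x y b → y - x + (x + b) ≡ b + y
  left-up = solve-∀
  right-up : ∀ x a b → a - b + (x + b) ≡ a + x
  right-up = solve-∀

zigzagEdge⇔window : ∀ hasPrev hasNext v x y →
  (x <[ v ] y × pull hasPrev v + signed v 1 + x <[ not v ] pull true (not v) + pull hasNext (not v) + y)
  ⇔ y - x ∈ window v (edgeSpan hasPrev hasNext)
zigzagEdge⇔window hasPrev hasNext v x y = mk⇔ to from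
  where
  a = pull hasPrev v + signed v 1
  b = pull true (not v) + pull hasNext (not v)
  d = edgeSpan hasPrev hasNext
  to : x <[ v ] y × a + x <[ not v ] b + y → y - x ∈ window v d
  to (x<y , x′<y′) = ∈-window⇐ v d (Equivalence.to (<[]-rise v x y) x<y)
    (subst (y - x <[ v ]_) (pull-gap hasPrev hasNext v)
           (Equivalence.to (<[]-exchange v a b x y) (<[]-unflip v x′<y′)))
  from : y - x ∈ window v d → x <[ v ] y × a + x <[ not v ] b + y
  from j∈ with ∈-window⇒ v d j∈
  ... | 0<j , j<d = Equivalence.from (<[]-rise v x y) 0<j ,
    <[]-flip v (Equivalence.from (<[]-exchange v a b x y)
                                 (subst (y - x <[ v ]_) (sym (pull-gap hasPrev hasNext v)) j<d))

Admissible : Bool → Bool → ∀ {k} → Vec ℤ k → Set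
Admissible hasPrev v c = Zigzag v c × Zigzag (not v) (zigzagStep hasPrev v c)

admissibles : Bool → Bool → ℤ → ∀ k → List (Vec ℤ (suc k))
admissibles hasPrev v x zero    = L.[ x ∷ [] ]
admissibles hasPrev v x (suc k) =
  L.concatMap (λ j → L.map (x ∷_) (admissibles true (not v) (x + j) k)) (window v (edgeSpan hasPrev (positive k)))

∈-admissibles⇒ : ∀ hasPrev v x k {c} → c ∈ admissibles hasPrev v x k → V.head c ≡ x × Admissible hasPrev v c
∈-admissibles⇒ hasPrev v x zero    (here refl) = refl , tt , tt
∈-admissibles⇒ hasPrev v x (suc k) c∈
  with find (∈-concatMap⁻ (λ j → L.map (x ∷_) (admissibles true (not v) (x + j) k))
                          {xs = window v (edgeSpan hasPrev (positive k))} c∈)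
... | j , j∈ , c∈′ with ∈-map⁻ (x ∷_) c∈′
... | y ∷ ys , c′∈ , refl with ∈-admissibles⇒ true (not v) (x + j) k c′∈
... | refl , zz , zz′
  with Equivalence.from (zigzagEdge⇔window hasPrev (positive k) v x (x + j)) (subst (_∈ _) (sym (xyx⁻¹≈y x j)) j∈)
... | x<y , x′<y′ = refl , (x<y , zz) , (x′<y′ , zz′)

∈-admissibles⇐ : ∀ hasPrev v k {c : Vec ℤ (suc k)} →
  Admissible hasPrev v c → c ∈ admissibles hasPrev v (V.head c) k
∈-admissibles⇐ hasPrev v zero    {x ∷ []}     _                            = here refl
∈-admissibles⇐ hasPrev v (suc k) {x ∷ y ∷ ys} ((x<y , zz) , (x′<y′ , zz′)) =
  ∈-concatMap⁺ (λ j → L.map (x ∷_) (admissibles true (not v) (x + j) k))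
    (lose (Equivalence.to (zigzagEdge⇔window hasPrev (positive k) v x y) (x<y , x′<y′))
          (∈-map⁺ (x ∷_) (subst (λ z → y ∷ ys ∈ admissibles true (not v) z k) (step-back x y)
                                (∈-admissibles⇐ true (not v) k (zz , zz′)))))
  where
  step-back : ∀ x y → y ≡ x + (y - x)
  step-back = solve-∀

window-unique : ∀ v d → Unique (window v d)
window-unique v d = Unique.map⁺ (signed-suc-injective v) (Unique.upTo⁺ (d ∸ 1))
  where
  signed-suc-injective : ∀ v {m m′} → signed v (suc m) ≡ signed v (suc m′) → m ≡ m′
  signed-suc-injective true  refl = refl
  signed-suc-injective false refl = refl

length-window : ∀ v d → length (window v d) ≡ d ∸ 1
length-window v d = trans (length-map (signed v ∘ suc) (L.upTo (d ∸ 1))) (length-upTo (d ∸ 1))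

admissibles-unique : ∀ hasPrev v x k → Unique (admissibles hasPrev v x k)
admissibles-unique hasPrev v x zero    = All.[] AllPairs.∷ AllPairs.[]
admissibles-unique hasPrev v x (suc k) =
  Unique.concat⁺ (All.map⁺ (All.universal branch-unique _))
                 (AllPairs.map⁺ (AllPairs.map branches-disjoint (window-unique v (edgeSpan hasPrev (positive k)))))
  where
  branch : ℤ → List (Vec ℤ (suc (suc k)))
  branch j = L.map (x ∷_) (admissibles true (not v) (x + j) k)
  branch-unique : ∀ j → Unique (branch j)
  branch-unique j = Unique.map⁺ ∷-injectiveʳ (admissibles-unique true (not v) (x + j) k)
  second : ∀ {j c} → c ∈ branch j → V.head (V.tail c) ≡ x + j
  second {j} c∈ with ∈-map⁻ (x ∷_) c∈
  ... | c′ , c′∈ , refl = proj₁ (∈-admissibles⇒ true (not v) (x + j) k c′∈)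
  branches-disjoint : ∀ {j j′} → j ≢ j′ → Disjoint (branch j) (branch j′)
  branches-disjoint j≢j′ (c∈ , c∈′) = j≢j′ (∙-cancelˡ x _ _ (trans (sym (second c∈)) (second c∈′)))

length-concatMap : ∀ {A B : Set} (f : A → List B) N xs → (∀ a → length (f a) ≡ N) →
  length (L.concatMap f xs) ≡ length xs * N
length-concatMap f N L.[]       _   = refl
length-concatMap f N (a L.∷ as) |f| =
  trans (length-++ (f a)) (cong₂ ℕ._+_ (|f| a) (length-concatMap f N as |f|))

admissibleCount : Bool → ℕ → ℕ
admissibleCount hasPrev zero    = 1
admissibleCount hasPrev (suc k) = (edgeSpan hasPrev (positive k) ∸ 1) * admissibleCount true k

length-admissibles : ∀ hasPrev v x k → length (admissibles hasPrev v x k) ≡ admissibleCount hasPrev k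
length-admissibles hasPrev v x zero    = refl
length-admissibles hasPrev v x (suc k) =
  trans (length-concatMap _ (admissibleCount true k) (window v (edgeSpan hasPrev (positive k))) length-branch)
        (cong (ℕ._* admissibleCount true k) (length-window v (edgeSpan hasPrev (positive k))))
  where
  length-branch : ∀ j → length (L.map (x ∷_) (admissibles true (not v) (x + j) k)) ≡ admissibleCount true k
  length-branch j = trans (length-map (x ∷_) (admissibles true (not v) (x + j) k))
                          (length-admissibles true (not v) (x + j) k)

admissibleCount-inner : ∀ m → admissibleCount true (suc m) ≡ 2 * 3 ^ m
admissibleCount-inner zero    = refl
admissibleCount-inner (suc m) = trans (cong (3 *_) (admissibleCount-inner m)) (swap-factors (3 ^ m))
  where
  swap-factors : ∀ a → 3 * (2 * a) ≡ 2 * (3 * a)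
  swap-factors = ℕRing.solve-∀

step-zigzag : ∀ v {k} (c : Config (suc k)) → Zigzag v c → step (Path (suc k)) c ≡ zigzagStep false v c
step-zigzag v (x ∷ xs) zz = trans (step-Path (x ∷ xs)) (pathStep-zigzag nothing v x xs tt zz)

counted⇔admissible : ∀ {k} p (c : Config (suc (suc k))) →
  Counted (suc (suc k)) p c ⇔ (V.head c ≡ + 0 × ∃ λ v → Admissible false v c)
counted⇔admissible {k} p c@(x ∷ y ∷ ys) = mk⇔ to from
  where
  G = Path (suc (suc k))
  to : Counted (suc (suc k)) p c → V.head c ≡ + 0 × ∃ λ v → Admissible false v c
  to (p2 , c₁≡0 , alt) with alternating⇒zigzag c alt
  ... | v , zz = c₁≡0 , v , zz , period2⇒zigzag nothing v c returns
    where
    returns : pathStep nothing (zigzagStep false v c) ≡ c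
    returns = trans (sym (step-Path _)) (trans (cong (step G) (sym (step-zigzag v c zz))) (p2Config⇒period2 G p2))
  from : V.head c ≡ + 0 × (∃ λ v → Admissible false v c) → Counted (suc (suc k)) p c
  from (c₁≡0 , v , zz , zz′) = period2⇒p2Config G twice moves , c₁≡0 , zigzag⇒alternating v c zz
    where
    twice : step G (step G c) ≡ c
    twice = trans (cong (step G) (step-zigzag v c zz))
                  (trans (step-zigzag (not v) _ zz′) (zigzagStep-involutive false v c))
    moves : step G c ≢ c
    moves = zigzagStep-moves false v x y ys ∘ trans (sym (step-zigzag v c zz))

countedConfigs : ∀ k → List (Config (suc (suc k)))
countedConfigs k = admissibles false true (+ 0) (suc k) ++ admissibles false false (+ 0) (suc k)

∈-countedConfigs : ∀ k {c} → c ∈ countedConfigs k ⇔ (V.head c ≡ + 0 × ∃ λ v → Admissible false v c)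
∈-countedConfigs k = mk⇔ to from
  where
  to : ∀ {c} → c ∈ countedConfigs k → V.head c ≡ + 0 × ∃ λ v → Admissible false v c
  to c∈ with ∈-++⁻ (admissibles false true (+ 0) (suc k)) c∈
  ... | inj₁ c∈ᵗ = let c₁≡0 , adm = ∈-admissibles⇒ false true (+ 0) (suc k) c∈ᵗ in c₁≡0 , true , adm
  ... | inj₂ c∈ᶠ = let c₁≡0 , adm = ∈-admissibles⇒ false false (+ 0) (suc k) c∈ᶠ in c₁≡0 , false , adm
  from : ∀ {c} → V.head c ≡ + 0 × (∃ λ v → Admissible false v c) → c ∈ countedConfigs k
  from {_ ∷ _} (refl , true , adm)  = ∈-++⁺ˡ (∈-admissibles⇐ false true (suc k) adm)
  from {_ ∷ _} (refl , false , adm) =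
    ∈-++⁺ʳ (admissibles false true (+ 0) (suc k)) (∈-admissibles⇐ false false (suc k) adm)

countedConfigs-unique : ∀ k → Unique (countedConfigs k)
countedConfigs-unique k =
  Unique.++⁺ (admissibles-unique false true (+ 0) (suc k)) (admissibles-unique false false (+ 0) (suc k)) opposite
  where
  opposite : Disjoint (admissibles false true (+ 0) (suc k)) (admissibles false false (+ 0) (suc k))
  opposite {x ∷ y ∷ ys} (c∈ᵗ , c∈ᶠ) =
    <-asym (proj₁ (proj₁ (proj₂ (∈-admissibles⇒ false true (+ 0) (suc k) c∈ᵗ))))
           (proj₁ (proj₁ (proj₂ (∈-admissibles⇒ false false (+ 0) (suc k) c∈ᶠ))))

length-countedConfigs : ∀ m → length (countedConfigs (suc m)) ≡ 8 * 3 ^ m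
length-countedConfigs m = begin
  length (countedConfigs (suc m))
    ≡⟨ length-++ (admissibles false true (+ 0) (suc (suc m))) ⟩
  length (admissibles false true (+ 0) (suc (suc m))) ℕ.+ length (admissibles false false (+ 0) (suc (suc m)))
    ≡⟨ cong₂ ℕ._+_ (length-admissibles false true (+ 0) (suc (suc m)))
                   (length-admissibles false false (+ 0) (suc (suc m))) ⟩
  2 * admissibleCount true (suc m) ℕ.+ 2 * admissibleCount true (suc m)
    ≡⟨ cong (λ a → 2 * a ℕ.+ 2 * a) (admissibleCount-inner m) ⟩
  2 * (2 * 3 ^ m) ℕ.+ 2 * (2 * 3 ^ m)
    ≡⟨ doubled-twice (3 ^ m) ⟩
  8 * 3 ^ m ∎
  where
  open ≡-Reasoning
  doubled-twice : ∀ a → 2 * (2 * a) ℕ.+ 2 * (2 * a) ≡ 8 * a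
  doubled-twice = ℕRing.solve-∀

corollary3 : (n : ℕ) (h : 3 ≤ n) →
    Σ (List (Config n)) λ L →
    Unique L
    × (∀ C → (C ∈ L) ⇔ Counted n (≤-trans (s≤s z≤n) h) C)
    × length L ≡ 8 * 3 ^ (n ∸ 3)
corollary3 (suc (suc (suc m))) (s≤s (s≤s (s≤s z≤n))) =
  countedConfigs (suc m) ,
  countedConfigs-unique (suc m) ,
  (λ C → ⇔-trans (∈-countedConfigs (suc m)) (⇔-sym (counted⇔admissible (s≤s z≤n) C))) ,
  length-countedConfigs m
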